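{- Let $T$ be a tree with $n$ vertices. Then $\gamma_a(T)+\frac{n}{6}\geq \gamma_o(T)+\frac{1}{3}$, where $\gamma_a(T)$ and $\gamma_o(T)$ denote the global defensive and global offensive alliance numbers of $T$.
   Context: Let $G=(V,E)$ be a finite graph. For $S\subseteq V$, the boundary $\partial S$ is the set of vertices in $V\setminus S$ adjacent to at least one vertex of $S$. For $v\in V$, the closed neighborhood is $N[v]=\{v\}\cup\partial\{v\}$. A set $S\subseteq V$ is dominating if $S\cup\partial S=V$. A set $S$ is a defensive alliance if for every $v\in S$, $|N[v]\cap S|\geq |N[v]\cap (V\setminus S)|$; it is a global defensive alliance if it is also dominating. A set $S$ is an offensive alliance if for every $v\in\partial S$, $|N[v]\cap S|\geq |N[v]\setminus S|$; it is a global offensive alliance if it is also dominating. The global defensive (resp. offensive) alliance number $\gamma_a(G)$ (resp. $\gamma_o(G)$) is the minimum cardinality of a global defensive (resp. offensive) alliance of $G$. -}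

module Defs where

open import Data.Nat using (ℕ; zero; suc; _+_; _∸_; _≤_; _≥_)
open import Data.Bool using (Bool; true; false; T; _∧_; not)
open import Data.Fin using (Fin)
open import Data.Fin.Subset using (Subset; _∈_; _∉_; ∣_∣)
open import Data.List using (List; []; _∷_; length; filter)
open import Data.List.Relation.Unary.Unique.Propositional using (Unique)
open import Data.List.Relation.Unary.Linked using (Linked)
open import Data.List.Relation.Unary.Any using (Any)
open import Data.Product using (Σ; _×_; ∃; ∃-syntax)
open import Relation.Binary.PropositionalEquality using (_≡_)
open import Relation.Nullary using (¬_)
open import Relation.Nullary.Decidable using (does)
open import Data.Fin using (_≟_)
open import Data.Vec.Functional using ()
open import Data.Fin.Subset using (Side; inside)
open import Data.Vec using (lookup)
import Data.Bool.Properties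
import Data.Sum
import Data.List
open import Data.List using (allFin)

record Graph (n : ℕ) : Set where
  field
    adj       : Fin n → Fin n → Bool
    symmetric : ∀ u v → adj u v ≡ adj v u
    irreflex  : ∀ v → adj v v ≡ false
open Graph public

module _ {n : ℕ} (G : Graph n) where

  Adj : Fin n → Fin n → Set
  Adj u v = T (adj G u v)

  Walk : List (Fin n) → Set
  Walk = Linked Adj

  Connected : Set
  Connected = ∀ (u v : Fin n) → u ≡ v Data.Sum.⊎ ∃[ w ] Walk (u ∷ Data.List._++_ w (v ∷ []))

  HasCycle : Set
  HasCycle = Σ (Fin n) λ v₀ → Σ (List (Fin n)) λ rest → Σ (Fin n) λ vk →
    let cyc = v₀ ∷ Data.List._++_ rest (vk ∷ []) in
    (length rest ≥ 1) × Unique cyc × Walk cyc × Adj vk v₀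

  IsTree : Set
  IsTree = Connected × ¬ HasCycle

  inN : Fin n → Fin n → Bool
  inN v u = does (u ≟ v) Data.Bool.∨ adj G v u

  countIn : Subset n → Fin n → ℕ
  countIn S v = length (filter (λ u → Data.Bool.Properties.T? (inN v u ∧ lookup S u)) (allFin n))

  countOut : Subset n → Fin n → ℕ
  countOut S v = length (filter (λ u → Data.Bool.Properties.T? (inN v u ∧ not (lookup S u))) (allFin n))

  InBoundary : Subset n → Fin n → Set
  InBoundary S v = v ∉ S × ∃[ u ] (u ∈ S × Adj u v)

  Dominating : Subset n → Set
  Dominating S = ∀ v → v ∈ S Data.Sum.⊎ InBoundary S v

  DefensiveAlliance : Subset n → Set
  DefensiveAlliance S = ∀ v → v ∈ S → countIn S v ≥ countOut S v

  OffensiveAlliance : Subset n → Set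
  OffensiveAlliance S = ∀ v → InBoundary S v → countIn S v ≥ countOut S v

  GlobalDefensiveAlliance : Subset n → Set
  GlobalDefensiveAlliance S = DefensiveAlliance S × Dominating S

  GlobalOffensiveAlliance : Subset n → Set
  GlobalOffensiveAlliance S = OffensiveAlliance S × Dominating S

  IsMinCard : (Subset n → Set) → ℕ → Set
  IsMinCard P k = (Σ (Subset n) λ S → P S × ∣ S ∣ ≡ k) × (∀ S → P S → k ≤ ∣ S ∣)

  IsGlobalDefensiveAllianceNumber : ℕ → Set
  IsGlobalDefensiveAllianceNumber = IsMinCard GlobalDefensiveAlliance

  IsGlobalOffensiveAllianceNumber : ℕ → Set
  IsGlobalOffensiveAllianceNumber = IsMinCard GlobalOffensiveAlliance

module Submission where

open import Defs
open import Data.Bool using (Bool; true; false; T; _∧_; _∨_; not)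
open import Data.Bool.Properties using (T?; T-∧; T-∨; T-≡; ∧-zeroʳ; ∧-identityʳ; not-involutive)
open import Data.Empty using (⊥; ⊥-elim)
open import Data.Fin using (Fin; zero; suc; _≟_)
open import Data.Fin.Properties using (any?)
open import Data.Fin.Subset using (Subset; _∈_; _∉_; ∣_∣)
open import Data.List using (List; []; _∷_; _++_; length; filter; allFin)
import Data.List as List
open import Data.List.Relation.Unary.All as All using (All; []; _∷_)
open import Data.List.Relation.Unary.All.Properties using () renaming (++⁺ to All-++⁺)
open import Data.List.Relation.Unary.AllPairs using ([]; _∷_)
import Data.List.Relation.Unary.AllPairs.Properties as AllPairs
open import Data.List.Relation.Unary.Linked using ([]; [-]; _∷_)
open import Data.List.Relation.Unary.Unique.Propositional using (Unique)
open import Data.Nat using (ℕ; zero; suc; _+_; _*_; _≤_; _<_; _≥_; z≤n; s≤s)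
open import Data.Nat.Properties
  using (≤-refl; ≤-reflexive; ≤-trans; ≤-antisym; ≤-pred; ≤-<-trans; <-irrefl; <-cmp; ≮⇒≥;
         m<1+n⇒m<n∨m≡n; n≤0⇒n≡0; n≤1+n; 0≢1+n; m≤m+n; m≤n+m; +-comm; +-identityʳ;
         +-mono-≤; +-monoˡ-≤; *-monoʳ-≤; +-cancelˡ-≤; +-0-commutativeMonoid; module ≤-Reasoning)
open import Data.Nat.Solver using (module +-*-Solver)
open import Data.Product using (_×_; ∃-syntax; _,_; proj₁; proj₂)
open import Data.Sum using (_⊎_; inj₁; inj₂; [_,_])
open import Data.Unit using (tt)
open import Data.Vec using ([]; _∷_; lookup; tabulate)
open import Data.Vec.Properties using ([]=⇒lookup; lookup⇒[]=; lookup∘tabulate)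
open import Function using (_∘_; id)
open import Function.Bundles using (Equivalence)
open import Relation.Binary using (tri<; tri≈; tri>)
open import Relation.Binary.PropositionalEquality
  using (_≡_; _≢_; _≗_; refl; sym; trans; cong; cong₂; subst; module ≡-Reasoning)
open import Relation.Nullary using (¬_; Dec; does; yes; no; _×-dec_; _⊎-dec_)
open import Relation.Nullary.Decidable using (isYes; fromWitness; toWitness)
open import Relation.Unary using (Decidable)
open import Algebra.Properties.CommutativeMonoid.Sum +-0-commutativeMonoid
  using (sum-syntax; ∑-distrib-+; ∑-comm; sum-cong-≗; sum-replicate-zero)

open Equivalence using (to; from)
open +-*-Solver using (solve; _:+_; _:*_; _:=_; con)

-- Let S be a minimum global defensive alliance, W its complement, and c a proper
-- 2-colouring of T.  A vertex cover of a graph without isolated vertices is a global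
-- offensive alliance, which gives four upper bounds on γ_o:
--   * the two colour classes, so 2 γ_o ≤ n;
--   * S ∪ X_c and S ∪ X_¬c, where X_c is the set of vertices of W of colour c having a
--     neighbour in W; hence 2 γ_o ≤ 2|S| + K with K = #{v ∈ W with a neighbour in W}.
-- Double counting the edges between S and W, using that S dominates W, that S is a
-- defensive alliance, and that a tree has n - 1 edges, gives 3|W| + K + 2 ≤ 2n + |S|;
-- linear arithmetic combines the bounds.

-- Indicator of a Boolean; cardinalities are written as sums of indicators.
𝟙 : Bool → ℕ
𝟙 true  = 1
𝟙 false = 0

𝟙≤1 : ∀ b → 𝟙 b ≤ 1
𝟙≤1 true  = ≤-refl
𝟙≤1 false = z≤n

𝟙-T : ∀ {b} → T b → 1 ≤ 𝟙 b
𝟙-T {true} _ = ≤-refl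

𝟙-split : ∀ a c → 𝟙 (c ∧ a) + 𝟙 (not c ∧ a) ≡ 𝟙 a
𝟙-split a true  = +-identityʳ (𝟙 a)
𝟙-split a false = refl

𝟙-∨ : ∀ a b → 𝟙 (a ∨ b) ≤ 𝟙 a + 𝟙 b
𝟙-∨ true  b = m≤m+n 1 (𝟙 b)
𝟙-∨ false b = ≤-refl

∑-mono : ∀ {n} {f g : Fin n → ℕ} → (∀ i → f i ≤ g i) → ∑[ i < n ] f i ≤ ∑[ i < n ] g i
∑-mono {zero}  f≤g = z≤n
∑-mono {suc n} f≤g = +-mono-≤ (f≤g zero) (∑-mono (λ i → f≤g (suc i)))

∑-term : ∀ {n} (f : Fin n → ℕ) i → f i ≤ ∑[ j < n ] f j
∑-term f zero    = m≤m+n _ _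
∑-term f (suc i) = ≤-trans (∑-term (λ j → f (suc j)) i) (m≤n+m _ (f zero))

_==_ : ∀ {n} → Fin n → Fin n → Bool
u == v = does (u ≟ v)

==-T : ∀ {n} {u v : Fin n} → u ≡ v → T (u == v)
==-T {u = u} refl with u ≟ u
... | yes _  = tt
... | no u≢u = u≢u refl

∑-pick : ∀ {n} (x : Fin n) (b : Fin n → Bool) → ∑[ u < n ] 𝟙 (u == x ∧ b u) ≡ 𝟙 (b x)
∑-pick {suc n} zero    b = trans (cong (𝟙 (b zero) +_) (sum-replicate-zero n)) (+-identityʳ _)
∑-pick {suc n} (suc x) b = ∑-pick x (λ u → b (suc u))

∑-ones : ∀ n → ∑[ i < n ] 1 ≡ n
∑-ones zero    = refl
∑-ones (suc n) = cong suc (∑-ones n)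

𝟙-excluded-middle : ∀ b → 𝟙 b + 𝟙 (not b) ≡ 1
𝟙-excluded-middle true  = refl
𝟙-excluded-middle false = refl

∑-complement : ∀ {n} (f : Fin n → Bool) → ∑[ v < n ] 𝟙 (f v) + ∑[ v < n ] 𝟙 (not (f v)) ≡ n
∑-complement {n} f = trans (sym (∑-distrib-+ (λ v → 𝟙 (f v)) (λ v → 𝟙 (not (f v)))))
  (trans (sum-cong-≗ (λ v → 𝟙-excluded-middle (f v))) (∑-ones n))

count-tabulate : ∀ {a} {A : Set a} {n} (g : Fin n → A) (p : A → Bool) →
  length (filter (λ x → T? (p x)) (List.tabulate g)) ≡ ∑[ i < n ] 𝟙 (p (g i))
count-tabulate {n = zero}  g p = refl
count-tabulate {n = suc n} g p with p (g zero)
... | true  = cong suc (count-tabulate (λ i → g (suc i)) p)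
... | false = count-tabulate (λ i → g (suc i)) p

count-allFin : ∀ {n} (p : Fin n → Bool) →
  length (filter (λ u → T? (p u)) (allFin n)) ≡ ∑[ u < n ] 𝟙 (p u)
count-allFin p = count-tabulate (λ u → u) p

card-lookup : ∀ {n} (S : Subset n) → ∣ S ∣ ≡ ∑[ u < n ] 𝟙 (lookup S u)
card-lookup []          = refl
card-lookup (true ∷ S)  = cong suc (card-lookup S)
card-lookup (false ∷ S) = card-lookup S

card-tabulate : ∀ {n} (f : Fin n → Bool) → ∣ tabulate f ∣ ≡ ∑[ u < n ] 𝟙 (f u)
card-tabulate f = trans (card-lookup (tabulate f)) (sum-cong-≗ (λ u → cong 𝟙 (lookup∘tabulate f u)))

∑∑-distrib-+ : ∀ {m n} (f g : Fin m → Fin n → ℕ) →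
  ∑[ i < m ] ∑[ j < n ] (f i j + g i j) ≡ ∑[ i < m ] ∑[ j < n ] f i j + ∑[ i < m ] ∑[ j < n ] g i j
∑∑-distrib-+ {n = n} f g = trans (sum-cong-≗ (λ i → ∑-distrib-+ (f i) (g i)))
  (∑-distrib-+ (λ i → ∑[ j < n ] f i j) (λ i → ∑[ j < n ] g i j))

∈⇒T : ∀ {n} {S : Subset n} {u} → u ∈ S → T (lookup S u)
∈⇒T u∈S = from T-≡ ([]=⇒lookup u∈S)

T⇒∈ : ∀ {n} {S : Subset n} {u} → T (lookup S u) → u ∈ S
T⇒∈ {S = S} {u} t = lookup⇒[]= u S (to T-≡ t)

¬T⇒T-not : ∀ {b} → ¬ T b → T (not b)
¬T⇒T-not {true}  ¬t = ¬t tt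
¬T⇒T-not {false} _  = tt

¬T⇒≡false : ∀ {b} → ¬ T b → b ≡ false
¬T⇒≡false {true}  ¬t = ⊥-elim (¬t tt)
¬T⇒≡false {false} _  = refl

adj-sym : ∀ {n} (G : Graph n) {u v} → Adj G u v → Adj G v u
adj-sym G {u} {v} = subst T (symmetric G u v)

adj-irrefl : ∀ {n} (G : Graph n) {u v} → Adj G u v → u ≢ v
adj-irrefl G {u} a refl = subst T (irreflex G u) a

Least : ∀ {p} → (ℕ → Set p) → ℕ → Set p
Least P k = P k × (∀ {j} → P j → k ≤ j)

least-below : ∀ {p} {P : ℕ → Set p} → Decidable P → ∀ b → (∃[ k ] Least P k) ⊎ (∀ j → j < b → ¬ P j)
least-below P? zero = inj₂ (λ _ ())
least-below {P = P} P? (suc b) with least-below P? b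
... | inj₁ found = inj₁ found
... | inj₂ none with P? b
...   | yes pb = inj₁ (b , pb , λ {j} pj → ≮⇒≥ (λ j<b → none j j<b pj))
...   | no ¬pb = inj₂ below
  where
  below : ∀ j → j < suc b → ¬ P j
  below j j<1+b with m<1+n⇒m<n∨m≡n j<1+b
  ... | inj₁ j<b  = none j j<b
  ... | inj₂ refl = ¬pb

least-witness : ∀ {p} {P : ℕ → Set p} → Decidable P → ∀ {m} → P m → ∃[ k ] Least P k
least-witness P? {m} pm = [ id , (λ none → ⊥-elim (none m ≤-refl pm)) ] (least-below P? (suc m))

parity : ℕ → Bool
parity zero    = true
parity (suc k) = not (parity k)

combine-bounds : ∀ {g s w k x₁ x₂ p₁ p₂ n} → g ≤ s + x₁ → g ≤ s + x₂ → g ≤ p₁ → g ≤ p₂ →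
  x₁ + x₂ ≡ k → p₁ + p₂ ≡ n → s + w ≡ n → 3 * w + k + 2 ≤ 2 * n + s → 6 * g + 2 ≤ 6 * s + n
combine-bounds {g} {s} {w} {_} {x₁} {x₂} {p₁} {p₂} g₁ g₂ g₃ g₄ refl p-sum refl counted = begin
  6 * g + 2
    ≡⟨ solve 1 (λ g → con 6 :* g :+ con 2 := (g :+ g) :+ con 2 :* (g :+ g) :+ con 2) refl g ⟩
  (g + g) + 2 * (g + g) + 2
    ≤⟨ +-monoˡ-≤ 2 (+-mono-≤ (+-mono-≤ g₁ g₂) (*-monoʳ-≤ 2 (+-mono-≤ g₃ g₄))) ⟩
  (s + x₁) + (s + x₂) + 2 * (p₁ + p₂) + 2
    ≡⟨ cong (λ m → (s + x₁) + (s + x₂) + 2 * m + 2) p-sum ⟩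
  (s + x₁) + (s + x₂) + 2 * (s + w) + 2
    ≡⟨ solve 4 (λ s x₁ x₂ w → (s :+ x₁) :+ (s :+ x₂) :+ con 2 :* (s :+ w) :+ con 2
                             := (w :+ (x₁ :+ x₂) :+ con 2) :+ (con 4 :* s :+ w)) refl s x₁ x₂ w ⟩
  (w + (x₁ + x₂) + 2) + (4 * s + w)
    ≤⟨ +-monoˡ-≤ (4 * s + w) small ⟩
  3 * s + (4 * s + w)
    ≡⟨ solve 2 (λ s w → con 3 :* s :+ (con 4 :* s :+ w) := con 6 :* s :+ (s :+ w)) refl s w ⟩
  6 * s + (s + w) ∎
  where
  open ≤-Reasoning
  small : w + (x₁ + x₂) + 2 ≤ 3 * s
  small = +-cancelˡ-≤ (2 * w) _ _ (begin
    2 * w + (w + (x₁ + x₂) + 2)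
      ≡⟨ solve 2 (λ w k → con 2 :* w :+ (w :+ k :+ con 2) := con 3 :* w :+ k :+ con 2) refl w (x₁ + x₂) ⟩
    3 * w + (x₁ + x₂) + 2  ≤⟨ counted ⟩
    2 * (s + w) + s
      ≡⟨ solve 2 (λ s w → con 2 :* (s :+ w) :+ s := con 2 :* w :+ con 3 :* s) refl s w ⟩
    2 * w + 3 * s ∎)

-- Alliances and edge counting in an arbitrary graph.
module _ {n : ℕ} (G : Graph n) where

  nbrs : (Fin n → Bool) → Fin n → ℕ
  nbrs f v = ∑[ u < n ] 𝟙 (adj G v u ∧ f u)

  -- |N[v] ∩ f| splits into v itself and its open neighbourhood (the graph is loopless).
  closed-count : ∀ f v → ∑[ u < n ] 𝟙 (inN G v u ∧ f u) ≡ 𝟙 (f v) + nbrs f v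
  closed-count f v =
    trans (sum-cong-≗ split)
      (trans (∑-distrib-+ (λ u → 𝟙 (u == v ∧ f u)) (λ u → 𝟙 (adj G v u ∧ f u)))
        (cong (_+ nbrs f v) (∑-pick v f)))
    where
    split : ∀ u → 𝟙 (inN G v u ∧ f u) ≡ 𝟙 (u == v ∧ f u) + 𝟙 (adj G v u ∧ f u)
    split u with u ≟ v
    ... | yes refl rewrite irreflex G u = sym (+-identityʳ _)
    ... | no _     = refl

  countIn≡ : ∀ {S : Subset n} {f} → lookup S ≗ f → ∀ v → countIn G S v ≡ 𝟙 (f v) + nbrs f v
  countIn≡ {S} {f} S≗f v = trans (count-allFin (λ u → inN G v u ∧ lookup S u))
    (trans (sum-cong-≗ (λ u → cong (λ b → 𝟙 (inN G v u ∧ b)) (S≗f u))) (closed-count f v))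

  countOut≡ : ∀ {S : Subset n} {f} → lookup S ≗ f → ∀ v →
    countOut G S v ≡ 𝟙 (not (f v)) + nbrs (not ∘ f) v
  countOut≡ {S} {f} S≗f v = trans (count-allFin (λ u → inN G v u ∧ not (lookup S u)))
    (trans (sum-cong-≗ (λ u → cong (λ b → 𝟙 (inN G v u ∧ not b)) (S≗f u))) (closed-count (not ∘ f) v))

  VertexCover : (Fin n → Bool) → Set
  VertexCover f = ∀ {u v} → Adj G u v → T (f u) ⊎ T (f v)

  NoIsolatedVertex : Set
  NoIsolatedVertex = ∀ v → ∃[ u ] Adj G v u

  -- A vertex cover of a graph without isolated vertices is a global offensive alliance:
  -- a vertex outside the cover has all its (at least one) neighbours inside it.
  cover⇒goa : NoIsolatedVertex → ∀ f → VertexCover f → GlobalOffensiveAlliance G (tabulate f)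
  cover⇒goa noIsolated f cover = offensive , dominating
    where
    D≗f : lookup (tabulate f) ≗ f
    D≗f = lookup∘tabulate f

    inside : ∀ {v} → T (f v) → v ∈ tabulate f
    inside {v} t = T⇒∈ (subst T (sym (D≗f v)) t)

    outside : ∀ {v} → v ∉ tabulate f → ¬ T (f v)
    outside v∉ t = v∉ (inside t)

    nbr-in : ∀ {v u} → ¬ T (f v) → Adj G v u → T (f u)
    nbr-in ¬fv a with cover a
    ... | inj₁ fv = ⊥-elim (¬fv fv)
    ... | inj₂ fu = fu

    no-nbr-out : ∀ {v} → ¬ T (f v) → ∀ u → 𝟙 (adj G v u ∧ not (f u)) ≤ 0
    no-nbr-out {v} ¬fv u with adj G v u in e
    ... | false = z≤n
    ... | true with f u | nbr-in ¬fv (subst T (sym e) tt)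
    ...   | true | _ = z≤n

    offensive : OffensiveAlliance G (tabulate f)
    offensive v (v∉ , _) = begin
      countOut G (tabulate f) v          ≡⟨ countOut≡ {tabulate f} D≗f v ⟩
      𝟙 (not (f v)) + nbrs (not ∘ f) v   ≤⟨ +-mono-≤ (𝟙≤1 (not (f v))) no-out ⟩
      1                                  ≤⟨ some-in ⟩
      nbrs f v                           ≤⟨ m≤n+m _ _ ⟩
      𝟙 (f v) + nbrs f v                 ≡⟨ countIn≡ {tabulate f} D≗f v ⟨
      countIn G (tabulate f) v           ∎
      where
      open ≤-Reasoning
      ¬fv = outside v∉
      u = proj₁ (noIsolated v)
      a = proj₂ (noIsolated v)
      no-out : nbrs (not ∘ f) v ≤ 0
      no-out = ≤-trans (∑-mono (no-nbr-out ¬fv)) (≤-reflexive (sum-replicate-zero n))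
      some-in : 1 ≤ nbrs f v
      some-in = ≤-trans (𝟙-T (from T-∧ (a , nbr-in ¬fv a))) (∑-term (λ w → 𝟙 (adj G v w ∧ f w)) u)

    dominating : Dominating G (tabulate f)
    dominating v with T? (f v)
    ... | yes fv = inj₁ (inside fv)
    ... | no ¬fv = let (u , a) = noIsolated v in
      inj₂ ((λ v∈ → ¬fv (subst T (D≗f v) (∈⇒T v∈))) , u , inside (nbr-in ¬fv a) , adj-sym G a)

  degreeSum : ℕ
  degreeSum = ∑[ v < n ] ∑[ u < n ] 𝟙 (adj G v u)

  edges : (Fin n → Bool) → (Fin n → Bool) → ℕ
  edges X Y = ∑[ v < n ] ∑[ u < n ] 𝟙 (X v ∧ (adj G v u ∧ Y u))

  edges-sym : ∀ X Y → edges X Y ≡ edges Y X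
  edges-sym X Y = trans (sum-cong-≗ (λ v → sum-cong-≗ (λ u → flip v u)))
    (∑-comm (λ v u → 𝟙 (Y u ∧ (adj G u v ∧ X v))))
    where
    rotate : ∀ x a y → x ∧ (a ∧ y) ≡ y ∧ (a ∧ x)
    rotate true  a true  = refl
    rotate true  a false = ∧-zeroʳ a
    rotate false a true  = sym (∧-zeroʳ a)
    rotate false a false = refl
    flip : ∀ v u → 𝟙 (X v ∧ (adj G v u ∧ Y u)) ≡ 𝟙 (Y u ∧ (adj G u v ∧ X v))
    flip v u = cong 𝟙 (trans (rotate (X v) (adj G v u) (Y u))
                              (cong (λ a → Y u ∧ (a ∧ X v)) (symmetric G v u)))

  degreeSum-split : ∀ X →
    degreeSum ≡ (edges X X + edges X (not ∘ X)) + (edges (not ∘ X) X + edges (not ∘ X) (not ∘ X))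
  degreeSum-split X = begin
    degreeSum
      ≡⟨ sum-cong-≗ (λ v → sum-cong-≗ (λ u → quarter (X v) (adj G v u) (X u))) ⟩
    ∑[ v < n ] ∑[ u < n ] ((p v u + q v u) + (r v u + s v u))
      ≡⟨ ∑∑-distrib-+ (λ v u → p v u + q v u) (λ v u → r v u + s v u) ⟩
    ∑[ v < n ] ∑[ u < n ] (p v u + q v u) + ∑[ v < n ] ∑[ u < n ] (r v u + s v u)
      ≡⟨ cong₂ _+_ (∑∑-distrib-+ p q) (∑∑-distrib-+ r s) ⟩
    (edges X X + edges X (not ∘ X)) + (edges (not ∘ X) X + edges (not ∘ X) (not ∘ X)) ∎
    where
    open ≡-Reasoning
    p q r s : Fin n → Fin n → ℕ
    p v u = 𝟙 (X v ∧ (adj G v u ∧ X u))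
    q v u = 𝟙 (X v ∧ (adj G v u ∧ not (X u)))
    r v u = 𝟙 (not (X v) ∧ (adj G v u ∧ X u))
    s v u = 𝟙 (not (X v) ∧ (adj G v u ∧ not (X u)))
    quarter : ∀ x a y → 𝟙 a ≡ (𝟙 (x ∧ (a ∧ y)) + 𝟙 (x ∧ (a ∧ not y)))
                              + (𝟙 (not x ∧ (a ∧ y)) + 𝟙 (not x ∧ (a ∧ not y)))
    quarter true  true  true  = refl
    quarter true  true  false = refl
    quarter false true  true  = refl
    quarter false true  false = refl
    quarter true  false y     = refl
    quarter false false y     = refl

  ProperColouring : (Fin n → Bool) → Set
  ProperColouring c = ∀ {u v} → Adj G u v → c u ≡ not (c v)

  swap-colours : ∀ {c} → ProperColouring c → ProperColouring (not ∘ c)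
  swap-colours proper a = cong not (proper a)

  colour-class-cover : ∀ {c} → ProperColouring c → VertexCover c
  colour-class-cover {c} proper {u} {v} a with T? (c u)
  ... | yes cu  = inj₁ cu
  ... | no ¬cu  = inj₂ (not-false (trans (sym (proper a)) (¬T⇒≡false ¬cu)))
    where
    not-false : ∀ {b} → not b ≡ false → T b
    not-false {true} _ = tt

  module DefensiveCount (S : Subset n) (gda : GlobalDefensiveAlliance G S) where

    σ ω : Fin n → Bool
    σ = lookup S
    ω = not ∘ σ

    hasNbrInW : Fin n → Bool
    hasNbrInW v = isYes (any? (λ u → T? (adj G v u ∧ ω u)))

    nbr-in-W : ∀ {x y} → Adj G x y → ¬ T (σ y) → T (hasNbrInW x)
    nbr-in-W {y = y} a ¬σy = fromWitness (y , from T-∧ (a , ¬T⇒T-not ¬σy))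

    size-S size-W linked-W : ℕ
    size-S = ∑[ v < n ] 𝟙 (σ v)
    size-W = ∑[ v < n ] 𝟙 (ω v)
    linked-W = ∑[ v < n ] 𝟙 (ω v ∧ hasNbrInW v)

    dominated : ∀ {v} → ¬ T (σ v) → ∃[ u ] (Adj G v u × T (σ u))
    dominated {v} ¬σv with proj₂ gda v
    ... | inj₁ v∈S = ⊥-elim (¬σv (∈⇒T v∈S))
    ... | inj₂ (_ , u , u∈S , a) = u , adj-sym G a , ∈⇒T u∈S

    defended : ∀ {v} → T (σ v) → nbrs ω v ≤ nbrs σ v + 1
    defended {v} σv = begin
      nbrs ω v                 ≤⟨ m≤n+m _ _ ⟩
      𝟙 (ω v) + nbrs ω v       ≡⟨ countOut≡ {S} (λ _ → refl) v ⟨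
      countOut G S v           ≤⟨ proj₁ gda v (T⇒∈ σv) ⟩
      countIn G S v            ≡⟨ countIn≡ {S} (λ _ → refl) v ⟩
      𝟙 (σ v) + nbrs σ v       ≤⟨ +-monoˡ-≤ _ (𝟙≤1 (σ v)) ⟩
      1 + nbrs σ v             ≡⟨ +-comm 1 _ ⟩
      nbrs σ v + 1             ∎
      where open ≤-Reasoning

    -- |W| ≤ e(W,S), since every vertex of W has a neighbour in S
    W≤edges : size-W ≤ edges ω σ
    W≤edges = ∑-mono bound
      where
      bound : ∀ v → 𝟙 (ω v) ≤ ∑[ u < n ] 𝟙 (ω v ∧ (adj G v u ∧ σ u))
      bound v with σ v in e
      ... | true  = z≤n
      ... | false = let (u , a , σu) = dominated (subst T e) in
        ≤-trans (𝟙-T (from T-∧ (a , σu))) (∑-term (λ u → 𝟙 (adj G v u ∧ σ u)) u)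

    linked≤edges : linked-W ≤ edges ω ω
    linked≤edges = ∑-mono bound
      where
      bound : ∀ v → 𝟙 (ω v ∧ hasNbrInW v) ≤ ∑[ u < n ] 𝟙 (ω v ∧ (adj G v u ∧ ω u))
      bound v with σ v | T? (hasNbrInW v)
      ... | true  | _      = z≤n
      ... | false | no ¬h  = ≤-trans (≤-reflexive (cong 𝟙 (¬T⇒≡false ¬h))) z≤n
      ... | false | yes h  = let (u , t) = toWitness h in
        ≤-trans (𝟙≤1 (hasNbrInW v)) (≤-trans (𝟙-T t) (∑-term (λ u → 𝟙 (adj G v u ∧ ω u)) u))

    -- e(S,W) ≤ e(S,S) + |S| by summing the defensive inequality over S
    defended-edges : edges σ ω ≤ edges σ σ + size-S
    defended-edges = ≤-trans (∑-mono bound) (≤-reflexive (∑-distrib-+ inside (λ v → 𝟙 (σ v))))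
      where
      inside : Fin n → ℕ
      inside v = ∑[ u < n ] 𝟙 (σ v ∧ (adj G v u ∧ σ u))
      bound : ∀ v → ∑[ u < n ] 𝟙 (σ v ∧ (adj G v u ∧ ω u)) ≤ inside v + 𝟙 (σ v)
      bound v with σ v in e
      ... | true  = defended (subst T (sym e) tt)
      ... | false = ≤-trans (≤-reflexive (sum-replicate-zero n)) z≤n

    -- With at most n - 1 edges, 3|W| + K + 2 ≤ 2n + |S|:
    -- 3|W| + K ≤ 3e(W,S) + e(W,W) ≤ e(S,S) + |S| + e(S,W) + e(W,S) + e(W,W) = Σ deg + |S|.
    counting : degreeSum + 2 ≤ 2 * n → 3 * size-W + linked-W + 2 ≤ 2 * n + size-S
    counting few-edges = begin
      3 * size-W + linked-W + 2
        ≤⟨ +-monoˡ-≤ 2 (+-mono-≤ (*-monoʳ-≤ 3 W≤edges) linked≤edges) ⟩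
      3 * eWS + eWW + 2
        ≡⟨ solve 2 (λ x y → con 3 :* x :+ y :+ con 2 := x :+ (x :+ (x :+ y)) :+ con 2) refl eWS eWW ⟩
      eWS + (eWS + (eWS + eWW)) + 2
        ≡⟨ cong (λ m → m + (m + (eWS + eWW)) + 2) (edges-sym ω σ) ⟩
      eSW + (eSW + (eWS + eWW)) + 2
        ≤⟨ +-monoˡ-≤ 2 (+-monoˡ-≤ (eSW + (eWS + eWW)) defended-edges) ⟩
      (eSS + size-S) + (eSW + (eWS + eWW)) + 2
        ≡⟨ solve 5 (λ a s b c d → (a :+ s) :+ (b :+ (c :+ d)) :+ con 2 := (a :+ b) :+ (c :+ d) :+ con 2 :+ s)
                 refl eSS size-S eSW eWS eWW ⟩
      (eSS + eSW) + (eWS + eWW) + 2 + size-S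
        ≡⟨ cong (λ m → m + 2 + size-S) (degreeSum-split σ) ⟨
      degreeSum + 2 + size-S
        ≤⟨ +-monoˡ-≤ size-S few-edges ⟩
      2 * n + size-S ∎
      where
      open ≤-Reasoning
      eSS = edges σ σ
      eSW = edges σ ω
      eWS = edges ω σ
      eWW = edges ω ω

    linked-of : (Fin n → Bool) → Fin n → Bool
    linked-of c v = c v ∧ (ω v ∧ hasNbrInW v)

    extended : (Fin n → Bool) → Fin n → Bool
    extended c v = σ v ∨ linked-of c v

    in-linked-of : ∀ c {x y} → T (c x) → ¬ T (σ x) → Adj G x y → ¬ T (σ y) → T (extended c x)
    in-linked-of c cx ¬σx a ¬σy = from T-∨ (inj₂ (from T-∧ (cx , from T-∧ (¬T⇒T-not ¬σx , nbr-in-W a ¬σy))))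

    -- An edge inside W joins two vertices of W with W-neighbours and different colours.
    extended-cover : ∀ {c} → ProperColouring c → VertexCover (extended c)
    extended-cover {c} proper {u} {v} a with T? (σ u) | T? (σ v)
    ... | yes σu | _      = inj₁ (from T-∨ (inj₁ σu))
    ... | no _   | yes σv = inj₂ (from T-∨ (inj₁ σv))
    ... | no ¬σu | no ¬σv with colour-class-cover proper a
    ...   | inj₁ cu = inj₁ (in-linked-of c cu ¬σu a ¬σv)
    ...   | inj₂ cv = inj₂ (in-linked-of c cv ¬σv (adj-sym G a) ¬σu)

    alliance-bound : NoIsolatedVertex → ∀ {c} → ProperColouring c → degreeSum + 2 ≤ 2 * n →
      ∀ {go} → (∀ D → GlobalOffensiveAlliance G D → go ≤ ∣ D ∣) → 6 * go + 2 ≤ 6 * ∣ S ∣ + n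
    alliance-bound noIsolated {c} proper few-edges {go} go-least =
      subst (λ s → 6 * go + 2 ≤ 6 * s + n) (sym (card-lookup S))
        (combine-bounds (via-extended proper) (via-extended (swap-colours proper))
          (via-cover c (colour-class-cover proper))
          (via-cover (not ∘ c) (colour-class-cover (swap-colours proper)))
          split-linked (∑-complement c) (∑-complement σ) (counting few-edges))
      where
      X : (Fin n → Bool) → ℕ
      X c = ∑[ v < n ] 𝟙 (linked-of c v)

      via-cover : ∀ f → VertexCover f → go ≤ ∑[ v < n ] 𝟙 (f v)
      via-cover f cover = subst (go ≤_) (card-tabulate f) (go-least _ (cover⇒goa noIsolated f cover))

      via-extended : ∀ {c} → ProperColouring c → go ≤ size-S + X c
      via-extended {c} proper = ≤-trans (via-cover (extended c) (extended-cover proper))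
        (≤-trans (∑-mono (λ v → 𝟙-∨ (σ v) (linked-of c v)))
          (≤-reflexive (∑-distrib-+ (λ v → 𝟙 (σ v)) (λ v → 𝟙 (linked-of c v)))))

      split-linked : X c + X (not ∘ c) ≡ linked-W
      split-linked = trans (sym (∑-distrib-+ (λ v → 𝟙 (linked-of c v)) (λ v → 𝟙 (linked-of (not ∘ c) v))))
        (sum-cong-≗ (λ v → 𝟙-split (ω v ∧ hasNbrInW v) (c v)))

-- Breadth-first structure of a tree from a chosen root: depths, parents, and the fact
-- that every edge joins a vertex to its parent.
module RootedTree {n : ℕ} (G : Graph n) (connected : Connected G) (acyclic : ¬ HasCycle G)
                  (root : Fin n) where

  Reach : ℕ → Fin n → Set
  Reach zero    v = v ≡ root
  Reach (suc k) v = Reach k v ⊎ ∃[ u ] (Reach k u × Adj G u v)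

  reach? : ∀ k → Decidable (Reach k)
  reach? zero    v = v ≟ root
  reach? (suc k) v = reach? k v ⊎-dec any? (λ u → reach? k u ×-dec T? (adj G u v))

  reach-along : ∀ {k a} w v → Reach k a → Walk G (a ∷ w ++ v ∷ []) → ∃[ j ] Reach j v
  reach-along {k} []      v r (a ∷ _) = suc k , inj₂ (_ , r , a)
  reach-along {k} (b ∷ w) v r (a ∷ l) = reach-along w v (inj₂ (_ , r , a)) l

  reachable : ∀ v → ∃[ k ] Reach k v
  reachable v with connected root v
  ... | inj₁ refl     = 0 , refl
  ... | inj₂ (w , wk) = reach-along w v refl wk

  shortest : ∀ v → ∃[ k ] Least (λ j → Reach j v) k
  shortest v = least-witness (λ k → reach? k v) (proj₂ (reachable v))

  depth : Fin n → ℕ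
  depth v = proj₁ (shortest v)

  depth-reach : ∀ v → Reach (depth v) v
  depth-reach v = proj₁ (proj₂ (shortest v))

  depth-least : ∀ {v j} → Reach j v → depth v ≤ j
  depth-least {v} = proj₂ (proj₂ (shortest v))

  depth-adj : ∀ {u v} → Adj G u v → depth v ≤ suc (depth u)
  depth-adj {u} a = depth-least (inj₂ (u , depth-reach u , a))

  depth-zero : ∀ {v} → depth v ≡ 0 → v ≡ root
  depth-zero {v} d≡0 = subst (λ k → Reach k v) d≡0 (depth-reach v)

  depth-root : depth root ≡ 0
  depth-root = n≤0⇒n≡0 (depth-least {root} {0} refl)

  -- The parent of a non-root vertex is the neighbour through which it is reached at
  -- its depth; the root (and the impossible first case) default to the vertex itself.
  parentOf : ∀ {v} d → Reach d v → Fin n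
  parentOf {v} zero    _                  = v
  parentOf {v} (suc _) (inj₁ _)           = v
  parentOf     (suc _) (inj₂ (u , _ , _)) = u

  parent : Fin n → Fin n
  parent v = parentOf (depth v) (depth-reach v)

  parent-spec : ∀ {v k} → depth v ≡ suc k → depth (parent v) ≡ k × Adj G (parent v) v
  parent-spec {v} {k} d≡ = step (depth v) (depth-reach v) d≡
    where
    step : ∀ d (r : Reach d v) → d ≡ suc k → depth (parentOf d r) ≡ k × Adj G (parentOf d r) v
    step .(suc k) (inj₁ r) refl = ⊥-elim (<-irrefl d≡ (s≤s (depth-least r)))
    step .(suc k) (inj₂ (u , r , a)) refl =
      ≤-antisym (depth-least r) (≤-pred (subst (_≤ suc (depth u)) d≡ (depth-adj a))) , a

  walk-snoc : ∀ x mid y z → Walk G (x ∷ mid ++ y ∷ []) → Adj G y z →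
              Walk G (x ∷ (mid ++ y ∷ []) ++ z ∷ [])
  walk-snoc x []      y z (a ∷ [-]) b = a ∷ b ∷ [-]
  walk-snoc x (m ∷ w) y z (a ∷ l)   b = a ∷ walk-snoc m w y z l b

  unique-snoc : ∀ {zs : List (Fin n)} {y} → Unique zs → All (_≢ y) zs → Unique (zs ++ y ∷ [])
  unique-snoc u y∉ = AllPairs.++⁺ u ([] ∷ []) (All.map (_∷ []) y∉)

  shallower-distinct : ∀ {a d} {zs : List (Fin n)} → depth a ≡ d →
                       All (λ z → d < depth z) zs → All (a ≢_) zs
  shallower-distinct da = All.map (λ { d<dz refl → <-irrefl (sym da) d<dz })

  -- Two distinct vertices of equal depth d are never joined by a path whose interior
  -- lies strictly deeper than d: climbing to the parents either closes a cycle or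
  -- produces the same situation one level higher, and at depth 0 there is only the root.
  no-deep-path : ∀ d x y mid → depth x ≡ d → depth y ≡ d → x ≢ y →
    All (λ z → d < depth z) mid → Unique mid → Walk G (x ∷ mid ++ y ∷ []) → ⊥
  no-deep-path zero x y mid dx dy x≢y _ _ _ = x≢y (trans (depth-zero dx) (sym (depth-zero dy)))
  no-deep-path (suc d) x y mid dx dy x≢y deep uniq walk with parent-spec dx | parent-spec dy
  ... | dpx , apx | dpy , apy = climb (parent x ≟ parent y)
    where
    path = x ∷ mid ++ y ∷ []

    path-unique : Unique path
    path-unique = All-++⁺ (shallower-distinct dx deep) (x≢y ∷ [])
                ∷ unique-snoc uniq (All.map (λ y≢z z≡y → y≢z (sym z≡y))
                                            (shallower-distinct dy deep))

    path-deep : All (λ z → d < depth z) path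
    path-deep = subst (d <_) (sym dx) ≤-refl
              ∷ All-++⁺ (All.map (≤-<-trans (n≤1+n d)) deep) (subst (d <_) (sym dy) ≤-refl ∷ [])

    climb : Dec (parent x ≡ parent y) → ⊥
    climb (yes px≡py) = acyclic (parent x , x ∷ mid , y , s≤s z≤n ,
      shallower-distinct dpx path-deep ∷ path-unique , apx ∷ walk ,
      subst (λ p → Adj G y p) (sym px≡py) (adj-sym G apy))
    climb (no px≢py) =
      no-deep-path d (parent x) (parent y) path dpx dpy px≢py path-deep path-unique
        (apx ∷ walk-snoc x mid y (parent y) walk (adj-sym G apy))

  parent-unique : ∀ {u v} → Adj G u v → depth v ≡ suc (depth u) → parent v ≡ u
  parent-unique {u} {v} a dv with parent v ≟ u | parent-spec dv
  ... | yes p≡u | _        = p≡u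
  ... | no p≢u  | dp , ap  = ⊥-elim (no-deep-path (depth u) u (parent v) (v ∷ []) refl dp
    (λ u≡p → p≢u (sym u≡p)) (subst (depth u <_) (sym dv) ≤-refl ∷ []) ([] ∷ [])
    (a ∷ adj-sym G ap ∷ [-]))

  ParentEdge : Fin n → Fin n → Set
  ParentEdge u v = depth v ≡ suc (depth u) × parent v ≡ u

  edge-orientation : ∀ {u v} → Adj G u v → ParentEdge u v ⊎ ParentEdge v u
  edge-orientation {u} {v} a with <-cmp (depth u) (depth v)
  ... | tri< du<dv _ _ = inj₁ (dv≡ , parent-unique a dv≡)
    where dv≡ = ≤-antisym (depth-adj a) du<dv
  ... | tri≈ _ du≡dv _ =
    ⊥-elim (no-deep-path (depth u) u v [] refl (sym du≡dv) (adj-irrefl G a) [] [] (a ∷ [-]))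
  ... | tri> _ _ dv<du = inj₂ (du≡ , parent-unique (adj-sym G a) du≡)
    where du≡ = ≤-antisym (depth-adj (adj-sym G a)) dv<du

  colour : Fin n → Bool
  colour v = parity (depth v)

  colour-proper : ProperColouring G colour
  colour-proper a with edge-orientation a
  ... | inj₁ (dv , _) = sym (trans (cong (not ∘ parity) dv) (not-involutive _))
  ... | inj₂ (du , _) = cong parity du

  nonroot : Fin n → Bool
  nonroot v = not (v == root)

  child-nonroot : ∀ {u v} → ParentEdge u v → T (nonroot v)
  child-nonroot {v = v} (dv , _) with v ≟ root
  ... | yes refl = 0≢1+n (trans (sym depth-root) dv)
  ... | no _     = tt

  -- Each edge is counted by the parent link of its lower endpoint.
  edge-parent-link : ∀ v u →
    𝟙 (adj G v u) ≤ 𝟙 (u == parent v ∧ nonroot v) + 𝟙 (v == parent u ∧ nonroot u)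
  edge-parent-link v u with adj G v u in e
  ... | false = z≤n
  ... | true with edge-orientation (subst T (sym e) tt)
  ...   | inj₁ pe@(_ , pu) = ≤-trans (𝟙-T (from T-∧ (==-T (sym pu) , child-nonroot pe))) (m≤n+m _ _)
  ...   | inj₂ pe@(_ , pv) = ≤-trans (𝟙-T (from T-∧ (==-T (sym pv) , child-nonroot pe))) (m≤m+n _ _)

  nonroot-count : ∑[ v < n ] 𝟙 (nonroot v) + 1 ≡ n
  nonroot-count = begin
    ∑[ v < n ] 𝟙 (nonroot v) + 1                          ≡⟨ +-comm _ 1 ⟩
    1 + ∑[ v < n ] 𝟙 (nonroot v)                          ≡⟨ cong (_+ ∑[ v < n ] 𝟙 (nonroot v)) root-once ⟨
    ∑[ v < n ] 𝟙 (v == root) + ∑[ v < n ] 𝟙 (nonroot v)  ≡⟨ ∑-complement (_== root) ⟩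
    n ∎
    where
    open ≡-Reasoning
    root-once : ∑[ v < n ] 𝟙 (v == root) ≡ 1
    root-once = trans (sum-cong-≗ (λ v → cong 𝟙 (sym (∧-identityʳ (v == root)))))
                      (∑-pick root (λ _ → true))

  degree-sum : degreeSum G + 2 ≤ 2 * n
  degree-sum = begin
    degreeSum G + 2                                  ≤⟨ +-monoˡ-≤ 2 (∑-mono (λ v → ∑-mono (edge-parent-link v))) ⟩
    ∑[ v < n ] ∑[ u < n ] (up v u + down v u) + 2    ≡⟨ cong (_+ 2) (∑∑-distrib-+ up down) ⟩
    ∑[ v < n ] ∑[ u < n ] up v u + ∑[ v < n ] ∑[ u < n ] down v u + 2
      ≡⟨ cong (λ m → ∑[ v < n ] ∑[ u < n ] up v u + m + 2) (∑-comm down) ⟩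
    ∑[ v < n ] ∑[ u < n ] up v u + ∑[ u < n ] ∑[ v < n ] down v u + 2
      ≡⟨ cong (λ m → m + m + 2) (sum-cong-≗ (λ v → ∑-pick (parent v) (λ _ → nonroot v))) ⟩
    R + R + 2                                        ≡⟨ solve 1 (λ r → r :+ r :+ con 2 := con 2 :* (r :+ con 1)) refl R ⟩
    2 * (R + 1)                                      ≡⟨ cong (2 *_) nonroot-count ⟩
    2 * n ∎
    where
    open ≤-Reasoning
    up down : Fin n → Fin n → ℕ
    up   v u = 𝟙 (u == parent v ∧ nonroot v)
    down v u = 𝟙 (v == parent u ∧ nonroot u)
    R = ∑[ v < n ] 𝟙 (nonroot v)

another : ∀ {m} (v : Fin (suc (suc m))) → ∃[ w ] v ≢ w
another zero    = suc zero , λ ()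
another (suc _) = zero , λ ()

connected⇒no-isolated : ∀ {n} (G : Graph n) → (∀ v → ∃[ w ] v ≢ w) → Connected G →
                        NoIsolatedVertex G
connected⇒no-isolated G other connected v with other v
... | w , v≢w with connected v w
...   | inj₁ v≡w            = ⊥-elim (v≢w v≡w)
...   | inj₂ ([] , a ∷ _)    = w , a
...   | inj₂ (u ∷ _ , a ∷ _) = u , a

-- Root the tree at vertex 0: its depth parity is a proper 2-colouring and it has n - 1
-- edges, so alliance-bound applies to a minimum global defensive alliance S.
mainTheorem2 : (n : ℕ) → n ≥ 2 → (T : Graph n) → IsTree T →
    (ga go : ℕ) → IsGlobalDefensiveAllianceNumber T ga → IsGlobalOffensiveAllianceNumber T go →
      6 * ga + n ≥ 6 * go + 2
mainTheorem2 (suc zero) (s≤s ())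
mainTheorem2 (suc (suc m)) _ T (connected , acyclic) ga go ((S , gda , |S|≡ga) , _) (_ , go-least) =
  subst (λ s → 6 * go + 2 ≤ 6 * s + suc (suc m)) |S|≡ga
    (DefensiveCount.alliance-bound T S gda (connected⇒no-isolated T another connected)
      colour-proper degree-sum go-least)
  where open RootedTree T connected acyclic zero
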